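{- Let $q$ be a prime power, $n\ge 2$, and let $r$ be the number of points of $\mathrm{PG}(n,q)$. Let $\psi$ be a bijection from the points of $\mathrm{PG}(n,q)$ to $[r]$, and let $\Psi=\{f_\psi: f\in\mathrm{PGL}(n+1,q)\}\le \mathcal{S}_r$. If $s\in\mathcal{S}_{r,n+2}$ is a frame (via $\psi$), then the number of permutations in $\Psi$ that cover $s$ is $|\Psi|/(n+2)!$.
   Context: $\mathrm{PG}(n,q)$ is the set of 1-dimensional subspaces (points) of $V=\mathrm{GF}(q)^{n+1}$; a hyperplane is the set of points contained in an $n$-dimensional subspace of $V$. A projectivity is a permutation of points induced by a matrix in $\mathrm{GL}(n+1,q)$; these form the group $\mathrm{PGL}(n+1,q)$. For a bijection $\psi$ from points to $[r]=\{0,\dots,r-1\}$, $f_\psi\in\mathcal{S}_r$ is defined by $f_\psi(i)=\psi(f(\psi^{ -1}(i)))$. A frame is an ordered sequence of $n+2$ points, no $n+1$ of which lie in a common hyperplane; via $\psi$ a frame is regarded as a sequence in $\mathcal{S}_{r,n+2}$, the set of ordered sequences of $n+2$ distinct elements of $[r]$. A permutation $\pi\in\mathcal{S}_r$ covers $s\in\mathcal{S}_{r,k}$ if $\pi^{ -1}(s_i)<\pi^{ -1}(s_{i+1})$ for all $i\in\{1,\dots,k-1\}$. -}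

module Defs where

open import Level using (0ℓ)
open import Algebra.Bundles using (CommutativeRing)
open import Data.Nat using (ℕ; zero; suc; _<_)
open import Data.Fin using (Fin; toℕ; inject₁; _≟_) renaming (suc to fsuc; zero to fzero)
open import Data.Vec using (Vec; lookup)
open import Data.List using (List; length)
open import Data.List.Membership.Propositional using (_∈_)
open import Data.List.Relation.Unary.Unique.Propositional using (Unique)
open import Data.Product using (Σ; ∃; _×_; _,_)
open import Function.Definitions using (Injective)
open import Relation.Binary.PropositionalEquality using (_≡_; _≢_)
open import Relation.Nullary using (¬_; yes; no)

HasSize : {A : Set} → (A → Set) → ℕ → Set
HasSize {A} P k = Σ (List A) λ L → Unique L × (length L ≡ k) × (∀ x → (P x → x ∈ L) × (x ∈ L → P x))

record IsFiniteField (F : CommutativeRing 0ℓ 0ℓ) (q : ℕ) : Set where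
  open CommutativeRing F
  field
    0≉1     : ¬ (0# ≈ 1#)
    inverse : ∀ x → ¬ (x ≈ 0#) → ∃ λ y → (x * y) ≈ 1#
    enum    : Fin q → Carrier
    enum-inj : ∀ i j → enum i ≈ enum j → i ≡ j
    enum-surj : ∀ x → ∃ λ i → enum i ≈ x

module Geometry (F : CommutativeRing 0ℓ 0ℓ) where
  open CommutativeRing F

  Vect : ℕ → Set
  Vect m = Fin m → Carrier

  Matrix : ℕ → Set
  Matrix m = Fin m → Fin m → Carrier

  Σ[_] : ∀ {m} → (Fin m → Carrier) → Carrier
  Σ[_] {zero}  f = 0#
  Σ[_] {suc m} f = f fzero + Σ[ (λ i → f (fsuc i)) ]

  NonZero : ∀ {m} → Vect m → Set
  NonZero v = ¬ (∀ i → v i ≈ 0#)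

  SamePoint : ∀ {m} → Vect m → Vect m → Set
  SamePoint v w = ∃ λ c → ¬ (c ≈ 0#) × (∀ i → v i ≈ (c * w i))

  apply : ∀ {m} → Matrix m → Vect m → Vect m
  apply A v i = Σ[ (λ j → A i j * v j) ]

  mul : ∀ {m} → Matrix m → Matrix m → Matrix m
  mul A B i k = Σ[ (λ j → A i j * B j k) ]

  identity : ∀ {m} → Matrix m
  identity i j with i ≟ j
  ... | yes _ = 1#
  ... | no _ = 0#

  Invertible : ∀ {m} → Matrix m → Set
  Invertible A = ∃ λ B → (∀ i j → mul A B i j ≈ identity i j) × (∀ i j → mul B A i j ≈ identity i j)

  -- ψ : (nonzero vectors, i.e. points of PG(n,q)) → [r] is a bijection from the
  -- set of points onto Fin r.  ψ is given on all vectors; only its values on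
  -- nonzero vectors matter.
  IsPointBijection : ∀ {m r} → (Vect m → Fin r) → Set
  IsPointBijection {m} {r} ψ =
    (∀ v w → NonZero v → NonZero w → (ψ v ≡ ψ w → SamePoint v w) × (SamePoint v w → ψ v ≡ ψ w))
    × (∀ i → ∃ λ v → NonZero v × (ψ v ≡ i))

  -- π (a permutation table of [r]) lies in Ψ = { f_ψ : f ∈ PGL(m,q) }:
  -- π = f_ψ, i.e. π(ψ(⟨v⟩)) = ψ(⟨A v⟩) for all points ⟨v⟩.
  InΨ : ∀ {m r} → (Vect m → Fin r) → Vec (Fin r) r → Set
  InΨ {m} ψ π = ∃ λ (A : Matrix m) → Invertible A × (∀ v → NonZero v → lookup π (ψ v) ≡ ψ (apply A v))

  OnHyperplane : ∀ {m r} → (Vect m → Fin r) → Vect m → Fin r → Set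
  OnHyperplane ψ c i = ∃ λ v → NonZero v × (ψ v ≡ i) × (Σ[ (λ j → c j * v j) ] ≈ 0#)

  -- s ∈ S_{r,k}: an ordered sequence of k distinct elements of [r]
  -- frame (for m = n+1, k = n+2): no n+1 of the points lie in a common
  -- hyperplane, i.e. for every omitted index j and every hyperplane, some
  -- point other than the j-th is off the hyperplane.
  IsFrame : ∀ {m r k} → (Vect m → Fin r) → (Fin k → Fin r) → Set
  IsFrame {m} {r} {k} ψ s =
    ∀ (j : Fin k) (c : Vect m) → NonZero c →
      ¬ (∀ i → i ≢ j → OnHyperplane ψ c (s i))

-- π covers s : π⁻¹(s_i) < π⁻¹(s_{i+1}) for consecutive indices
Covers : ∀ {r k} → Vec (Fin r) r → (Fin (suc k) → Fin r) → Set
Covers {r} {k} π s = ∀ (i : Fin k) (a b : Fin r) →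
  lookup π a ≡ s (inject₁ i) → lookup π b ≡ s (fsuc i) → toℕ a < toℕ b

module Submission where

-- For two frame points s_p ≠ s_k, the other n frame points lie on a hyperplane H missing both,
-- and the reflection x ↦ x + u (d·x) fixing H pointwise with u on the line s_p s_k is a projectivity
-- swapping s_p and s_k and fixing every other frame point.  Composing with it is a bijection of Ψ
-- that exchanges the positions of s_p and s_k in a permutation.  So among the permutations of Ψ
-- that put s_0, …, s_(k-1) in order, s_k is equally often in each of the k + 1 possible slots:
-- if c_k counts those permutations, c_k = (k + 1) c_(k+1), whence |Ψ| = c_0 = (n + 2)! c_(n+2).

open import Level using (0ℓ)
open import Algebra.Bundles using (CommutativeRing)
open import Data.Nat using (ℕ; suc)
open import Data.Fin using (Fin)
open import Defs

module Counting where

  open import Data.Nat using (_+_; _≤_; z≤n; s≤s)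
  open import Data.Nat.Properties using (≤-antisym; +-suc)
  open import Data.List using (List; []; _∷_; length; map; filter)
  open import Data.List.Properties using (length-map; length-removeAt′)
  open import Data.List.Membership.Propositional using (_∈_)
  open import Data.List.Membership.Propositional.Properties using (∈-map⁻; ∈-filter⁺; ∈-filter⁻)
  open import Data.List.Relation.Binary.Subset.Propositional using (_⊆_)
  open import Data.List.Relation.Unary.Any using (here; there; _─_)
  import Data.List.Relation.Unary.All as All
  open import Data.List.Relation.Unary.AllPairs using (_∷_)
  open import Data.List.Relation.Unary.Unique.Propositional using (Unique)
  import Data.List.Relation.Unary.Unique.Propositional.Properties as Unique
  open import Data.Product using (_×_; _,_; proj₁; proj₂)
  open import Relation.Binary.PropositionalEquality using (_≡_; _≢_; refl; sym; trans; cong; subst)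
  open import Relation.Nullary using (¬_; yes; no)
  open import Relation.Unary using (Pred; Decidable)
  open import Relation.Unary.Properties using (_∩?_; ∁?)
  open import Data.Empty using (⊥-elim)
  open import Function using (_∘_)

  module _ {A : Set} where

    ∈-─ : ∀ {x z} {ys : List A} (x∈ys : x ∈ ys) → z ∈ ys → z ≢ x → z ∈ (ys ─ x∈ys)
    ∈-─ (here refl) (here refl) z≢x = ⊥-elim (z≢x refl)
    ∈-─ (here refl) (there z∈ys) _  = z∈ys
    ∈-─ (there _)   (here refl) _   = here refl
    ∈-─ (there x∈ys) (there z∈ys) z≢x = there (∈-─ x∈ys z∈ys z≢x)

    Unique⇒length-≤ : ∀ {xs ys : List A} → Unique xs → xs ⊆ ys → length xs ≤ length ys
    Unique⇒length-≤ {[]} _ _ = z≤n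
    Unique⇒length-≤ {x ∷ xs} {ys} (x∉xs ∷ xs!) xs⊆ys =
      subst (suc (length xs) ≤_) (sym (length-removeAt′ ys _))
        (s≤s (Unique⇒length-≤ xs! λ z∈xs → ∈-─ x∈ys (xs⊆ys (there z∈xs)) λ { refl → All.lookup x∉xs z∈xs refl }))
      where x∈ys = xs⊆ys (here refl)

    Unique⇒length-≡ : ∀ {xs ys : List A} → Unique xs → Unique ys → xs ⊆ ys → ys ⊆ xs → length xs ≡ length ys
    Unique⇒length-≡ xs! ys! xs⊆ys ys⊆xs = ≤-antisym (Unique⇒length-≤ xs! xs⊆ys) (Unique⇒length-≤ ys! ys⊆xs)

    count : {P : Pred A 0ℓ} → Decidable P → List A → ℕ
    count P? xs = length (filter P? xs)

    module _ {P Q : Pred A 0ℓ} (P? : Decidable P) (Q? : Decidable Q) where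

      count-cong : ∀ xs → (∀ {x} → x ∈ xs → P x → Q x) → (∀ {x} → x ∈ xs → Q x → P x) →
                   count P? xs ≡ count Q? xs
      count-cong [] _ _ = refl
      count-cong (x ∷ xs) P⇒Q Q⇒P with P? x | Q? x
      ... | yes _  | yes _  = cong suc (count-cong xs (P⇒Q ∘ there) (Q⇒P ∘ there))
      ... | yes Px | no ¬Qx = ⊥-elim (¬Qx (P⇒Q (here refl) Px))
      ... | no ¬Px | yes Qx = ⊥-elim (¬Px (Q⇒P (here refl) Qx))
      ... | no _   | no _   = count-cong xs (P⇒Q ∘ there) (Q⇒P ∘ there)

      count-split : ∀ xs → count P? xs ≡ count (P? ∩? Q?) xs + count (P? ∩? ∁? Q?) xs
      count-split [] = refl
      count-split (x ∷ xs) with P? x | Q? x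
      ... | yes _ | yes _ = cong suc (count-split xs)
      ... | yes _ | no _  = trans (cong suc (count-split xs)) (sym (+-suc _ _))
      ... | no _  | _     = count-split xs

      count-≤-injection : ∀ {xs} → Unique xs → (h : A → A) → (∀ {x y} → h x ≡ h y → x ≡ y) →
                          (∀ {x} → x ∈ xs → P x → h x ∈ xs × Q (h x)) → count P? xs ≤ count Q? xs
      count-≤-injection {xs} xs! h h-inj maps = subst (_≤ count Q? xs) (length-map h (filter P? xs))
        (Unique⇒length-≤ (Unique.map⁺ h-inj (Unique.filter⁺ P? xs!)) image⊆)
        where
        image⊆ : map h (filter P? xs) ⊆ filter Q? xs
        image⊆ y∈ with ∈-map⁻ h y∈
        ... | x , x∈ , refl with ∈-filter⁻ P? x∈
        ...   | x∈xs , Px = ∈-filter⁺ Q? (proj₁ (maps x∈xs Px)) (proj₂ (maps x∈xs Px))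

module Insertion where

  open import Data.Nat using (zero; _+_; _*_; _!; _≤_; _<_; _<?_; z<s)
  open import Data.Nat.Properties
  open import Data.List using (List; length)
  open import Data.List.Properties using (filter-all)
  import Data.List.Relation.Unary.All as All
  open import Data.List.Membership.Propositional using (_∈_)
  open import Data.List.Relation.Unary.Unique.Propositional using (Unique)
  open import Data.Product using (_×_; _,_; proj₁)
  open import Relation.Binary.PropositionalEquality using (_≡_; _≢_; refl; sym; trans; cong; cong₂; subst; subst₂; module ≡-Reasoning)
  open import Relation.Nullary using (¬_; Dec; yes; no)
  open import Relation.Nullary.Decidable using (_×-dec_; _→-dec_)
  open import Relation.Unary using (Decidable)
  open import Relation.Unary.Properties using (_∩?_; ∁?)
  open import Data.Empty using (⊥-elim)
  open import Function using (_∘_)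
  open Counting

  Sorted : (ℕ → ℕ) → ℕ → Set
  Sorted f m = ∀ {j} → j < m → ∀ {i} → i < j → f i < f j

  sorted? : ∀ f m → Dec (Sorted f m)
  sorted? f m = allUpTo? (λ j → allUpTo? (λ i → f i <? f j) j) m

  adjacent⇒Sorted : ∀ {f m} → (∀ {i} → suc i < m → f i < f (suc i)) → Sorted f m
  adjacent⇒Sorted adjacent {suc j} j<m {i} i≤j with i ≟ j
  ... | yes refl = adjacent j<m
  ... | no i≢j = <-trans (adjacent⇒Sorted adjacent (<-trans (n<1+n j) j<m) (≤∧≢⇒< (≤-pred i≤j) i≢j)) (adjacent j<m)

  record Transposition {X : Set} (L : List X) (rank : X → ℕ → ℕ) (N p k : ℕ) : Set where
    field
      τ             : X → X
      τ-injective   : ∀ {x y} → τ x ≡ τ y → x ≡ y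
      τ-∈           : ∀ {x} → x ∈ L → τ x ∈ L
      rank-τ-p      : ∀ x → rank (τ x) p ≡ rank x k
      rank-τ-k      : ∀ x → rank (τ x) k ≡ rank x p
      rank-τ-other  : ∀ x {i} → i < N → i ≢ p → i ≢ k → rank (τ x) i ≡ rank x i

  module InsertionCount {X : Set} (N : ℕ) (rank : X → ℕ → ℕ) (L : List X) (L! : Unique L)
    (rank-injective : ∀ {x} → x ∈ L → ∀ {i j} → i < N → j < N → rank x i ≡ rank x j → i ≡ j)
    (transposition : ∀ {p k} → p < k → k < N → Transposition L rank N p k) where

    Past : ℕ → ℕ → X → Set
    Past p k x = Sorted (rank x) k × (∀ {i} → i < p → rank x i < rank x k)

    Slot : ℕ → ℕ → X → Set
    Slot p k x = Past p k x × (∀ {i} → i < k → p ≤ i → rank x k < rank x i)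

    Sorted? : ∀ m → Decidable (λ x → Sorted (rank x) m)
    Sorted? m x = sorted? (rank x) m

    Past? : ∀ p k → Decidable (Past p k)
    Past? p k x = Sorted? k x ×-dec allUpTo? (λ i → rank x i <? rank x k) p

    Slot? : ∀ p k → Decidable (Slot p k)
    Slot? p k x = Past? p k x ×-dec allUpTo? (λ i → (p ≤? i) →-dec (rank x k <? rank x i)) k

    module _ {p k : ℕ} (p<k : p < k) (k<N : k < N) where
      open Transposition (transposition p<k k<N)

      private
        <N : ∀ {i} → i < k → i < N
        <N i<k = <-trans i<k k<N

        other : ∀ x {i} → i < k → i ≢ p → rank (τ x) i ≡ rank x i
        other x i<k i≢p = rank-τ-other x (<N i<k) i≢p (<⇒≢ i<k)

      Slot-τ : ∀ {x} → Slot p k x → Slot (suc p) k (τ x)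
      Slot-τ {x} ((sorted , before) , after) = (sorted′ , before′) , after′
        where
        sorted′ : Sorted (rank (τ x)) k
        sorted′ {j} j<k {i} i<j with j ≟ p | i ≟ p
        ... | yes refl | _ = subst₂ _<_ (sym (other x (<-trans i<j j<k) (<⇒≢ i<j))) (sym (rank-τ-p x)) (before i<j)
        ... | no j≢p | yes refl = subst₂ _<_ (sym (rank-τ-p x)) (sym (other x j<k j≢p)) (after j<k (<⇒≤ i<j))
        ... | no j≢p | no i≢p = subst₂ _<_ (sym (other x (<-trans i<j j<k) i≢p)) (sym (other x j<k j≢p)) (sorted j<k i<j)
        before′ : ∀ {i} → i < suc p → rank (τ x) i < rank (τ x) k
        before′ {i} i≤p with i ≟ p
        ... | yes refl = subst₂ _<_ (sym (rank-τ-p x)) (sym (rank-τ-k x)) (after p<k ≤-refl)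
        ... | no i≢p = subst₂ _<_ (sym (other x (<-trans i<p p<k) i≢p)) (sym (rank-τ-k x)) (sorted p<k i<p)
          where i<p = ≤∧≢⇒< (≤-pred i≤p) i≢p
        after′ : ∀ {i} → i < k → suc p ≤ i → rank (τ x) k < rank (τ x) i
        after′ i<k p<i = subst₂ _<_ (sym (rank-τ-k x)) (sym (other x i<k (>⇒≢ p<i))) (sorted i<k p<i)

      τ-Slot : ∀ {x} → Slot (suc p) k x → Slot p k (τ x)
      τ-Slot {x} ((sorted , before) , after) = (sorted′ , before′) , after′
        where
        sorted′ : Sorted (rank (τ x)) k
        sorted′ {j} j<k {i} i<j with j ≟ p | i ≟ p
        ... | yes refl | _ = subst₂ _<_ (sym (other x (<-trans i<j j<k) (<⇒≢ i<j))) (sym (rank-τ-p x)) (before (m<n⇒m<1+n i<j))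
        ... | no j≢p | yes refl = subst₂ _<_ (sym (rank-τ-p x)) (sym (other x j<k j≢p)) (after j<k i<j)
        ... | no j≢p | no i≢p = subst₂ _<_ (sym (other x (<-trans i<j j<k) i≢p)) (sym (other x j<k j≢p)) (sorted j<k i<j)
        before′ : ∀ {i} → i < p → rank (τ x) i < rank (τ x) k
        before′ i<p = subst₂ _<_ (sym (other x (<-trans i<p p<k) (<⇒≢ i<p))) (sym (rank-τ-k x)) (sorted p<k i<p)
        after′ : ∀ {i} → i < k → p ≤ i → rank (τ x) k < rank (τ x) i
        after′ {i} i<k p≤i with i ≟ p
        ... | yes refl = subst₂ _<_ (sym (rank-τ-k x)) (sym (rank-τ-p x)) (before ≤-refl)
        ... | no i≢p = subst₂ _<_ (sym (rank-τ-k x)) (sym (other x i<k i≢p)) (sorted i<k (≤∧≢⇒< p≤i (i≢p ∘ sym)))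

      count-Slot-suc : count (Slot? p k) L ≡ count (Slot? (suc p) k) L
      count-Slot-suc = ≤-antisym
        (count-≤-injection (Slot? p k) (Slot? (suc p) k) L! τ τ-injective λ x∈L s → τ-∈ x∈L , Slot-τ s)
        (count-≤-injection (Slot? (suc p) k) (Slot? p k) L! τ τ-injective λ x∈L s → τ-∈ x∈L , τ-Slot s)

      private
        Overtakes? : Decidable (λ x → rank x k < rank x p)
        Overtakes? x = rank x k <? rank x p

      count-Past-split : count (Past? p k) L ≡ count (Slot? p k) L + count (Past? (suc p) k) L
      count-Past-split = trans (count-split (Past? p k) Overtakes? L) (cong₂ _+_
        (count-cong (Past? p k ∩? Overtakes?) (Slot? p k) L (λ _ → overtaken⇒Slot) (λ _ → Slot⇒overtaken))
        (count-cong (Past? p k ∩? ∁? Overtakes?) (Past? (suc p) k) L notOvertaken⇒Past (λ _ → Past⇒notOvertaken)))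
        where
        overtaken⇒Slot : ∀ {x} → Past p k x × rank x k < rank x p → Slot p k x
        overtaken⇒Slot {x} (past@(sorted , _) , k<p) = past , after
          where
          after : ∀ {i} → i < k → p ≤ i → rank x k < rank x i
          after {i} i<k p≤i with i ≟ p
          ... | yes refl = k<p
          ... | no i≢p = <-trans k<p (sorted i<k (≤∧≢⇒< p≤i (i≢p ∘ sym)))
        Slot⇒overtaken : ∀ {x} → Slot p k x → Past p k x × rank x k < rank x p
        Slot⇒overtaken (past , after) = past , after p<k ≤-refl
        notOvertaken⇒Past : ∀ {x} → x ∈ L → Past p k x × ¬ (rank x k < rank x p) → Past (suc p) k x
        notOvertaken⇒Past {x} x∈L ((sorted , before) , k≮p) = sorted , before′
          where
          before′ : ∀ {i} → i < suc p → rank x i < rank x k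
          before′ {i} i≤p with i ≟ p
          ... | yes refl = ≤∧≢⇒< (≮⇒≥ k≮p) (<⇒≢ p<k ∘ rank-injective x∈L (<-trans p<k k<N) k<N)
          ... | no i≢p = before (≤∧≢⇒< (≤-pred i≤p) i≢p)
        Past⇒notOvertaken : ∀ {x} → Past (suc p) k x → Past p k x × ¬ (rank x k < rank x p)
        Past⇒notOvertaken (sorted , before) = (sorted , before ∘ m<n⇒m<1+n) , <⇒≯ (before ≤-refl)

    module _ {k : ℕ} (k<N : k < N) where

      private
        Sorted⇒Past : ∀ {x} → Sorted (rank x) (suc k) → Past k k x
        Sorted⇒Past sorted = (sorted ∘ m<n⇒m<1+n) , sorted ≤-refl

        Past⇒Sorted : ∀ {x} → Past k k x → Sorted (rank x) (suc k)
        Past⇒Sorted (sorted , before) {j} j≤k with j ≟ k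
        ... | yes refl = before
        ... | no j≢k = sorted (≤∧≢⇒< (≤-pred j≤k) j≢k)

      count-Slot : ∀ d {p} → p + d ≡ k → count (Slot? p k) L ≡ count (Sorted? (suc k)) L
      count-Slot zero {p} p+0≡k rewrite +-identityʳ p | p+0≡k =
        count-cong (Slot? k k) (Sorted? (suc k)) L (λ _ → Past⇒Sorted ∘ proj₁)
          (λ _ s → Sorted⇒Past s , λ i<k k≤i → ⊥-elim (<⇒≱ i<k k≤i))
      count-Slot (suc d) {p} p+1+d≡k = trans (count-Slot-suc p<k k<N) (count-Slot d (trans (sym (+-suc p d)) p+1+d≡k))
        where p<k = subst (p <_) p+1+d≡k (m<m+n p z<s)

      count-Past : ∀ d {p} → p + d ≡ k → count (Past? p k) L ≡ suc d * count (Sorted? (suc k)) L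
      count-Past zero {p} p+0≡k rewrite +-identityʳ p | p+0≡k =
        trans (count-cong (Past? k k) (Sorted? (suc k)) L (λ _ → Past⇒Sorted) (λ _ → Sorted⇒Past)) (sym (*-identityˡ _))
      count-Past (suc d) {p} p+1+d≡k = trans (count-Past-split p<k k<N) (cong₂ _+_
        (count-Slot (suc d) p+1+d≡k) (count-Past d (trans (sym (+-suc p d)) p+1+d≡k)))
        where p<k = subst (p <_) p+1+d≡k (m<m+n p z<s)

      count-Sorted-suc : count (Sorted? k) L ≡ suc k * count (Sorted? (suc k)) L
      count-Sorted-suc = trans
        (count-cong (Sorted? k) (Past? 0 k) L (λ _ s → s , λ ()) (λ _ → proj₁)) (count-Past k refl)

    count-Sorted-! : ∀ d {j} → j + d ≡ N → j ! * count (Sorted? j) L ≡ N ! * count (Sorted? N) L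
    count-Sorted-! zero {j} j+0≡N rewrite +-identityʳ j | j+0≡N = refl
    count-Sorted-! (suc d) {j} j+1+d≡N = begin
      j ! * count (Sorted? j) L                   ≡⟨ cong (j ! *_) (count-Sorted-suc j<N) ⟩
      j ! * (suc j * count (Sorted? (suc j)) L)   ≡⟨ sym (*-assoc (j !) (suc j) _) ⟩
      j ! * suc j * count (Sorted? (suc j)) L     ≡⟨ cong (_* count (Sorted? (suc j)) L) (*-comm (j !) (suc j)) ⟩
      suc j ! * count (Sorted? (suc j)) L         ≡⟨ count-Sorted-! d (trans (sym (+-suc j d)) j+1+d≡N) ⟩
      N ! * count (Sorted? N) L                   ∎
      where
      open ≡-Reasoning
      j<N = subst (j <_) j+1+d≡N (m<m+n j z<s)

    length≡!*count-Sorted : length L ≡ N ! * count (Sorted? N) L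
    length≡!*count-Sorted = begin
      length L                      ≡⟨ cong length (sym (filter-all (Sorted? 0) (All.universal (λ _ ()) L))) ⟩
      count (Sorted? 0) L           ≡⟨ sym (*-identityˡ _) ⟩
      0 ! * count (Sorted? 0) L     ≡⟨ count-Sorted-! N refl ⟩
      N ! * count (Sorted? N) L     ∎
      where open ≡-Reasoning

module Positions where

  open import Data.Nat using (_<_; _<?_; s≤s; _*_; _!)
  open import Data.Nat.Properties using (n<1+n; <-trans; <⇒≢)
  open import Data.Fin using (toℕ; fromℕ<; inject₁; _≟_) renaming (zero to fzero; suc to fsuc)
  open import Data.Fin.Properties using (toℕ-fromℕ<; fromℕ<-toℕ; fromℕ<-injective; toℕ<n; toℕ-inject₁; toℕ-injective; suc-injective)
  open import Data.Vec using (Vec; []; _∷_; lookup; map)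
  open import Data.Vec.Properties using (map-∘; map-cong; map-id)
  open import Data.List using (List; filter)
  open import Data.List.Membership.Propositional using (_∈_)
  open import Data.List.Membership.Propositional.Properties using (∈-filter⁺; ∈-filter⁻)
  open import Data.List.Relation.Binary.Subset.Propositional using (_⊆_)
  import Data.List.Relation.Unary.Unique.Propositional.Properties as Unique
  open import Data.Product using (∃; _×_; _,_; proj₁; proj₂)
  open import Relation.Binary.PropositionalEquality using (_≡_; _≢_; refl; sym; trans; cong; subst; subst₂)
  open import Relation.Nullary using (yes; no)
  open import Data.Empty using (⊥-elim)
  open import Function using (_∘_)
  open Counting using (Unique⇒length-≡)
  open Insertion using (Sorted; adjacent⇒Sorted; Transposition; module InsertionCount)

  module _ {r : ℕ} where

    position : ∀ {m} → Vec (Fin r) m → Fin r → ℕ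
    position []       x = 0
    position (y ∷ ys) x with y ≟ x
    ... | yes _ = 0
    ... | no _  = suc (position ys x)

    position-lookup : ∀ {m} (π : Vec (Fin r) m) → (∀ {a b} → lookup π a ≡ lookup π b → a ≡ b) →
                      ∀ a → position π (lookup π a) ≡ toℕ a
    position-lookup (y ∷ ys) π-inj fzero with y ≟ y
    ... | yes _ = refl
    ... | no y≢y = ⊥-elim (y≢y refl)
    position-lookup (y ∷ ys) π-inj (fsuc a) with y ≟ lookup ys a
    ... | yes y≡ = ⊥-elim (fzero≢fsuc (π-inj y≡))
      where fzero≢fsuc : fzero ≢ fsuc a
            fzero≢fsuc ()
    ... | no _ = cong suc (position-lookup ys (suc-injective ∘ π-inj) a)

    position-map : ∀ {m} {g : Fin r → Fin r} → (∀ {x y} → g x ≡ g y → x ≡ y) →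
                   (π : Vec (Fin r) m) (y : Fin r) → position (map g π) (g y) ≡ position π y
    position-map g-inj [] y = refl
    position-map {g = g} g-inj (z ∷ zs) y with g z ≟ g y | z ≟ y
    ... | yes _     | yes _   = refl
    ... | yes gz≡gy | no z≢y  = ⊥-elim (z≢y (g-inj gz≡gy))
    ... | no gz≢gy  | yes z≡y = ⊥-elim (gz≢gy (cong g z≡y))
    ... | no _      | no _    = cong suc (position-map g-inj zs y)

  record IsPermutation {r} (π : Vec (Fin r) r) : Set where
    field
      injective  : ∀ {a b} → lookup π a ≡ lookup π b → a ≡ b
      surjective : ∀ y → ∃ λ a → lookup π a ≡ y

  record Swap {r N : ℕ} (Ψ : Vec (Fin r) r → Set) (s : Fin N → Fin r) (p k : Fin N) : Set where
    field
      g           : Fin r → Fin r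
      involutive  : ∀ y → g (g y) ≡ y
      g-p         : g (s p) ≡ s k
      g-other     : ∀ {i} → i ≢ p → i ≢ k → g (s i) ≡ s i
      map-g-Ψ     : ∀ {π} → Ψ π → Ψ (map g π)

  module SequenceRanks {r N′ : ℕ} (s : Fin (suc N′) → Fin r) where

    N : ℕ
    N = suc N′

    -- Indices i ≥ N never occur; sending them to s 0 makes at total.
    at : ℕ → Fin r
    at i with i <? N
    ... | yes i<N = s (fromℕ< i<N)
    ... | no _    = s fzero

    at-toℕ : ∀ f → at (toℕ f) ≡ s f
    at-toℕ f with toℕ f <? N
    ... | yes f<N = cong s (fromℕ<-toℕ f f<N)
    ... | no f≮N  = ⊥-elim (f≮N (toℕ<n f))

    at-< : ∀ {i} (i<N : i < N) → at i ≡ s (fromℕ< i<N)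
    at-< i<N = subst (λ i → at i ≡ s (fromℕ< i<N)) (toℕ-fromℕ< i<N) (at-toℕ (fromℕ< i<N))

    rank : Vec (Fin r) r → ℕ → ℕ
    rank π i = position π (at i)

    module _ {π : Vec (Fin r) r} (perm : IsPermutation π) where

      open IsPermutation perm renaming (injective to π-inj; surjective to π-surj)

      rank-lookup : ∀ {a f} → lookup π a ≡ s f → rank π (toℕ f) ≡ toℕ a
      rank-lookup {a} {f} πa≡sf = trans (cong (position π) (trans (at-toℕ f) (sym πa≡sf))) (position-lookup π π-inj a)

      rank-injective : (∀ {i j} → s i ≡ s j → i ≡ j) → ∀ {i j} → i < N → j < N → rank π i ≡ rank π j → i ≡ j
      rank-injective s-inj {i} {j} i<N j<N eq with π-surj (s (fromℕ< i<N)) | π-surj (s (fromℕ< j<N))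
      ... | a , πa | b , πb = fromℕ<-injective i j i<N j<N (s-inj (trans (sym πa) (trans (cong (lookup π) a≡b) πb)))
        where
        rank-fromℕ< : ∀ {a i} (i<N : i < N) → lookup π a ≡ s (fromℕ< i<N) → rank π i ≡ toℕ a
        rank-fromℕ< i<N πa = trans (cong (rank π) (sym (toℕ-fromℕ< i<N))) (rank-lookup πa)
        a≡b = toℕ-injective (trans (sym (rank-fromℕ< i<N πa)) (trans eq (rank-fromℕ< j<N πb)))

      Covers⇒Sorted : Covers π s → Sorted (rank π) N
      Covers⇒Sorted covers = adjacent⇒Sorted adjacent
        where
        adjacent : ∀ {i} → suc i < N → rank π i < rank π (suc i)
        adjacent {i} (s≤s i<N′) with π-surj (s (inject₁ f)) | π-surj (s (fsuc f))
          where f = fromℕ< i<N′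
        ... | a , πa | b , πb = subst₂ _<_
          (trans (sym (rank-lookup πa)) (cong (rank π) (trans (toℕ-inject₁ _) (toℕ-fromℕ< i<N′))))
          (trans (sym (rank-lookup πb)) (cong (rank π ∘ suc) (toℕ-fromℕ< i<N′)))
          (covers _ a b πa πb)

      Sorted⇒Covers : Sorted (rank π) N → Covers π s
      Sorted⇒Covers sorted f a b πa πb = subst₂ _<_
        (trans (cong (rank π) (sym (toℕ-inject₁ f))) (rank-lookup πa)) (rank-lookup πb)
        (sorted (s≤s (toℕ<n f)) (n<1+n (toℕ f)))

    module _ {Ψ : Vec (Fin r) r → Set} {L : List (Vec (Fin r) r)} (enumerates : ∀ π → (Ψ π → π ∈ L) × (π ∈ L → Ψ π))
             (swap : ∀ {p k : Fin N} → p ≢ k → Swap Ψ s p k) where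

      transposition : ∀ {p k} → p < k → k < N → Transposition L rank N p k
      transposition {p} {k} p<k k<N = record
        { τ            = map g
        ; τ-injective  = λ {π} {π′} eq → trans (sym (map-involutive π)) (trans (cong (map g) eq) (map-involutive π′))
        ; τ-∈          = λ {π} π∈L → proj₁ (enumerates (map g π)) (map-g-Ψ (proj₂ (enumerates π) π∈L))
        ; rank-τ-p     = λ π → trans (rank-map π p) (cong (position π) (trans (cong g (at-< p<N)) (trans g-p (sym (at-< k<N)))))
        ; rank-τ-k     = λ π → trans (rank-map π k) (cong (position π) (trans (cong g (at-< k<N))
                                  (trans (cong g (sym g-p)) (trans (involutive _) (sym (at-< p<N))))))
        ; rank-τ-other = λ π {i} i<N i≢p i≢k → trans (rank-map π i) (cong (position π) (trans (cong g (at-< i<N))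
                                  (trans (g-other (fromℕ<-≢ i<N p<N i≢p) (fromℕ<-≢ i<N k<N i≢k)) (sym (at-< i<N)))))
        }
        where
        p<N = <-trans p<k k<N
        fromℕ<-≢ : ∀ {i j} (i<N : i < N) (j<N : j < N) → i ≢ j → fromℕ< i<N ≢ fromℕ< j<N
        fromℕ<-≢ {i} {j} i<N j<N i≢j = i≢j ∘ fromℕ<-injective i j i<N j<N
        open Swap (swap (fromℕ<-≢ p<N k<N (<⇒≢ p<k)))
        g-injective : ∀ {x y} → g x ≡ g y → x ≡ y
        g-injective {x} {y} eq = trans (sym (involutive x)) (trans (cong g eq) (involutive y))
        map-involutive : ∀ π → map g (map g π) ≡ π
        map-involutive π = trans (sym (map-∘ g g π)) (trans (map-cong involutive π) (map-id π))
        rank-map : ∀ π i → rank (map g π) i ≡ position π (g (at i))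
        rank-map π i = trans (cong (position (map g π)) (sym (involutive (at i)))) (position-map g-injective π (g (at i)))

  covering-count : ∀ {r N′} {Ψ : Vec (Fin r) r → Set} (s : Fin (suc N′) → Fin r) → (∀ {i j} → s i ≡ s j → i ≡ j) →
                   (∀ {π} → Ψ π → IsPermutation π) → (∀ {p k} → p ≢ k → Swap Ψ s p k) →
                   ∀ {a b} → HasSize Ψ a → HasSize (λ π → Ψ π × Covers π s) b → a ≡ suc N′ ! * b
  covering-count {N′ = N′} {Ψ} s s-inj permutation swap (La , La! , refl , La-enum) (Lb , Lb! , refl , Lb-enum) =
    trans length≡!*count-Sorted (cong (suc N′ ! *_) (Unique⇒length-≡ (Unique.filter⁺ (Sorted? N) La!) Lb! sorted⊆ sorted⊇))
    where
    open SequenceRanks s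
    Ψ∈La : ∀ {π} → π ∈ La → Ψ π
    Ψ∈La {π} = proj₂ (La-enum π)
    open InsertionCount N rank La La! (λ {π} π∈La → rank-injective (permutation (Ψ∈La π∈La)) s-inj) (transposition La-enum swap)
    sorted⊆ : filter (Sorted? N) La ⊆ Lb
    sorted⊆ {π} π∈ with ∈-filter⁻ (Sorted? N) π∈
    ... | π∈La , sorted = proj₁ (Lb-enum π) (Ψ∈La π∈La , Sorted⇒Covers (permutation (Ψ∈La π∈La)) sorted)
    sorted⊇ : Lb ⊆ filter (Sorted? N) La
    sorted⊇ {π} π∈Lb with proj₂ (Lb-enum π) π∈Lb
    ... | Ψπ , covers = ∈-filter⁺ (Sorted? N) (proj₁ (La-enum π) Ψπ) (Covers⇒Sorted (permutation Ψπ) covers)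

module LinearAlgebra (F : CommutativeRing 0ℓ 0ℓ) where

  open import Data.Nat using (zero)
  open import Data.Fin using (_≟_; punchIn) renaming (zero to fzero; suc to fsuc)
  open import Data.Fin.Properties using (punchInᵢ≢i)
  open import Data.Product using (_,_; proj₁; proj₂)
  open import Relation.Binary.PropositionalEquality as ≡ using (_≡_; _≢_)
  open import Relation.Nullary using (yes; no)
  open import Data.Empty using (⊥-elim)
  open import Function using (_∘_)

  open CommutativeRing F
  open Geometry F
  open import Algebra.Properties.Semiring.Sum semiring using (sum; sum-cong-≋; sum-replicate-zero; sum-remove; ∑-distrib-+; ∑-comm; *-distribˡ-sum; *-distribʳ-sum)
  open import Algebra.Properties.Ring ring using (-1*x≈-x; -‿distribʳ-*; -‿+-comm)
  open import Algebra.Properties.CommutativeSemigroup *-commutativeSemigroup using (x∙yz≈y∙xz; xy∙z≈y∙xz)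
  open import Relation.Binary.Reasoning.Setoid setoid

  Σ≡sum : ∀ {m} (f : Fin m → Carrier) → Σ[ f ] ≡ sum f
  Σ≡sum {zero}  f = ≡.refl
  Σ≡sum {suc m} f = ≡.cong (f fzero +_) (Σ≡sum (f ∘ fsuc))

  Σ-cong : ∀ {m} {f g : Fin m → Carrier} → (∀ i → f i ≈ g i) → Σ[ f ] ≈ Σ[ g ]
  Σ-cong {f = f} {g} f≈g rewrite Σ≡sum f | Σ≡sum g = sum-cong-≋ f≈g

  Σ-zero : ∀ {m} {f : Fin m → Carrier} → (∀ i → f i ≈ 0#) → Σ[ f ] ≈ 0#
  Σ-zero {m} {f} f≈0 rewrite Σ≡sum f = trans (sum-cong-≋ f≈0) (sum-replicate-zero m)

  Σ-+ : ∀ {m} (f g : Fin m → Carrier) → Σ[ (λ i → f i + g i) ] ≈ Σ[ f ] + Σ[ g ]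
  Σ-+ f g rewrite Σ≡sum (λ i → f i + g i) | Σ≡sum f | Σ≡sum g = ∑-distrib-+ f g

  Σ-*ˡ : ∀ {m} (c : Carrier) (f : Fin m → Carrier) → Σ[ (λ i → c * f i) ] ≈ c * Σ[ f ]
  Σ-*ˡ c f rewrite Σ≡sum (λ i → c * f i) | Σ≡sum f = sym (*-distribˡ-sum c f)

  Σ-*ʳ : ∀ {m} (c : Carrier) (f : Fin m → Carrier) → Σ[ (λ i → f i * c) ] ≈ Σ[ f ] * c
  Σ-*ʳ c f rewrite Σ≡sum (λ i → f i * c) | Σ≡sum f = sym (*-distribʳ-sum c f)

  Σ-comm : ∀ {m k} (f : Fin m → Fin k → Carrier) → Σ[ (λ i → Σ[ f i ]) ] ≈ Σ[ (λ j → Σ[ (λ i → f i j) ]) ]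
  Σ-comm f = begin
    Σ[ (λ i → Σ[ f i ]) ]                 ≈⟨ Σ-cong (λ i → reflexive (Σ≡sum (f i))) ⟩
    Σ[ (λ i → sum (f i)) ]                ≡⟨ Σ≡sum (λ i → sum (f i)) ⟩
    sum (λ i → sum (f i))                 ≈⟨ ∑-comm f ⟩
    sum (λ j → sum (λ i → f i j))         ≡⟨ Σ≡sum (λ j → sum (λ i → f i j)) ⟨
    Σ[ (λ j → sum (λ i → f i j)) ]        ≈⟨ Σ-cong (λ j → reflexive (Σ≡sum (λ i → f i j))) ⟨
    Σ[ (λ j → Σ[ (λ i → f i j) ]) ]       ∎

  dot : ∀ {m} → Vect m → Vect m → Carrier
  dot c v = Σ[ (λ j → c j * v j) ]

  dot-cong : ∀ {m} {c c′ v v′ : Vect m} → (∀ i → c i ≈ c′ i) → (∀ i → v i ≈ v′ i) → dot c v ≈ dot c′ v′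
  dot-cong c≈c′ v≈v′ = Σ-cong (λ j → *-cong (c≈c′ j) (v≈v′ j))

  dot-congʳ : ∀ {m} (c : Vect m) {v v′ : Vect m} → (∀ i → v i ≈ v′ i) → dot c v ≈ dot c v′
  dot-congʳ c = dot-cong (λ _ → refl)

  dot-comm : ∀ {m} (c v : Vect m) → dot c v ≈ dot v c
  dot-comm c v = Σ-cong (λ j → *-comm (c j) (v j))

  dot-zeroʳ : ∀ {m} (c : Vect m) → dot c (λ _ → 0#) ≈ 0#
  dot-zeroʳ c = Σ-zero (λ j → zeroʳ (c j))

  dot-+ʳ : ∀ {m} (c v w : Vect m) → dot c (λ i → v i + w i) ≈ dot c v + dot c w
  dot-+ʳ c v w = trans (Σ-cong (λ j → distribˡ (c j) (v j) (w j))) (Σ-+ (λ j → c j * v j) (λ j → c j * w j))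

  dot-*ʳ : ∀ {m} (c v : Vect m) (a : Carrier) → dot c (λ i → a * v i) ≈ a * dot c v
  dot-*ʳ c v a = trans (Σ-cong (λ j → x∙yz≈y∙xz (c j) a (v j))) (Σ-*ˡ a (λ j → c j * v j))

  dot-*ˡ : ∀ {m} (c v : Vect m) (a : Carrier) → dot (λ i → c i * a) v ≈ a * dot c v
  dot-*ˡ c v a = trans (Σ-cong (λ j → xy∙z≈y∙xz (c j) a (v j))) (Σ-*ˡ a (λ j → c j * v j))

  dot-negʳ : ∀ {m} (c v : Vect m) → dot c (λ i → - v i) ≈ - dot c v
  dot-negʳ c v = trans (dot-congʳ c (λ i → sym (-1*x≈-x (v i)))) (trans (dot-*ʳ c v (- 1#)) (-1*x≈-x _))

  identity-diag : ∀ {m} (i : Fin m) → identity i i ≡ 1#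
  identity-diag i with i ≟ i
  ... | yes _  = ≡.refl
  ... | no i≢i = ⊥-elim (i≢i ≡.refl)

  identity-off : ∀ {m} {i j : Fin m} → i ≢ j → identity i j ≡ 0#
  identity-off {i = i} {j} i≢j with i ≟ j
  ... | yes i≡j = ⊥-elim (i≢j i≡j)
  ... | no _    = ≡.refl

  identity-sym : ∀ {m} (i j : Fin m) → identity i j ≡ identity j i
  identity-sym i j with i ≟ j
  ... | yes i≡j = ≡.sym (≡.subst (λ k → identity k i ≡ 1#) i≡j (identity-diag i))
  ... | no i≢j  = ≡.sym (identity-off (i≢j ∘ ≡.sym))

  dot-identity : ∀ {m} (i : Fin m) (v : Vect m) → dot (identity i) v ≈ v i
  dot-identity {suc m} i v = begin
    dot (identity i) v                                ≡⟨ Σ≡sum δv ⟩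
    sum δv                                            ≈⟨ sum-remove {i = i} δv ⟩
    δv i + sum (δv ∘ punchIn i)                       ≈⟨ +-cong (*-congʳ (reflexive (identity-diag i))) (sum-cong-≋ {m} off-diagonal) ⟩
    1# * v i + sum {m} (λ _ → 0#)                        ≈⟨ +-cong (*-identityˡ (v i)) (sum-replicate-zero m) ⟩
    v i + 0#                                          ≈⟨ +-identityʳ (v i) ⟩
    v i                                               ∎
    where
    δv : Vect (suc m)
    δv j = identity i j * v j
    off-diagonal : ∀ j → δv (punchIn i j) ≈ 0#
    off-diagonal j = trans (*-congʳ (reflexive (identity-off (punchInᵢ≢i i j ∘ ≡.sym)))) (zeroˡ _)

  dot-identityʳ : ∀ {m} (v : Vect m) (k : Fin m) → dot v (λ j → identity j k) ≈ v k
  dot-identityʳ v k = trans (dot-comm v _) (trans (dot-cong (λ j → reflexive (identity-sym j k)) (λ _ → refl)) (dot-identity k v))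

  apply-cong : ∀ {m} (A : Matrix m) {v w : Vect m} → (∀ i → v i ≈ w i) → ∀ i → apply A v i ≈ apply A w i
  apply-cong A v≈w i = dot-congʳ (A i) v≈w

  apply-congˡ : ∀ {m} {A B : Matrix m} → (∀ i j → A i j ≈ B i j) → ∀ v i → apply A v i ≈ apply B v i
  apply-congˡ A≈B v i = dot-cong (A≈B i) (λ _ → refl)

  apply-* : ∀ {m} (A : Matrix m) (a : Carrier) (v : Vect m) → ∀ i → apply A (λ j → a * v j) i ≈ a * apply A v i
  apply-* A a v i = dot-*ʳ (A i) v a

  apply-zero : ∀ {m} (A : Matrix m) → ∀ i → apply A (λ _ → 0#) i ≈ 0#
  apply-zero A i = dot-zeroʳ (A i)

  apply-identity : ∀ {m} (v : Vect m) → ∀ i → apply identity v i ≈ v i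
  apply-identity v i = dot-identity i v

  apply-mul : ∀ {m} (A B : Matrix m) (v : Vect m) → ∀ i → apply (mul A B) v i ≈ apply A (apply B v) i
  apply-mul A B v i = begin
    Σ[ (λ j → Σ[ (λ l → A i l * B l j) ] * v j) ]    ≈⟨ Σ-cong (λ j → Σ-*ʳ (v j) (λ l → A i l * B l j)) ⟨
    Σ[ (λ j → Σ[ (λ l → A i l * B l j * v j) ]) ]    ≈⟨ Σ-comm (λ j l → A i l * B l j * v j) ⟩
    Σ[ (λ l → Σ[ (λ j → A i l * B l j * v j) ]) ]    ≈⟨ Σ-cong (λ l → trans (Σ-cong (λ j → *-assoc (A i l) (B l j) (v j))) (Σ-*ˡ (A i l) (λ j → B l j * v j))) ⟩
    Σ[ (λ l → A i l * Σ[ (λ j → B l j * v j) ]) ]    ∎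

  mul-≈-identity : ∀ {m} {A B : Matrix m} → (∀ v i → apply A (apply B v) i ≈ v i) → ∀ i k → mul A B i k ≈ identity i k
  mul-≈-identity {A = A} {B} AB≈I i k =
    trans (apply-cong A (λ j → sym (dot-identityʳ (B j) k)) i) (AB≈I (λ j → identity j k) i)

  invertible : ∀ {m} {A B : Matrix m} → (∀ v i → apply A (apply B v) i ≈ v i) → (∀ v i → apply B (apply A v) i ≈ v i) → Invertible A
  invertible {B = B} AB≈I BA≈I = B , mul-≈-identity AB≈I , mul-≈-identity BA≈I

  module _ {m} (A : Matrix m) (inv : Invertible A) where

    inverse-applyˡ : ∀ v i → apply (proj₁ inv) (apply A v) i ≈ v i
    inverse-applyˡ v i = trans (sym (apply-mul (proj₁ inv) A v i)) (trans (apply-congˡ (proj₂ (proj₂ inv)) v i) (apply-identity v i))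

    inverse-applyʳ : ∀ v i → apply A (apply (proj₁ inv) v) i ≈ v i
    inverse-applyʳ v i = trans (sym (apply-mul A (proj₁ inv) v i)) (trans (apply-congˡ (proj₁ (proj₂ inv)) v i) (apply-identity v i))

    inverse-invertible : Invertible (proj₁ inv)
    inverse-invertible = A , proj₂ (proj₂ inv) , proj₁ (proj₂ inv)

    NonZero-apply : ∀ {v} → NonZero v → NonZero (apply A v)
    NonZero-apply {v} v≉0 Av≈0 = v≉0 λ i → begin
      v i                                ≈⟨ inverse-applyˡ v i ⟨
      apply (proj₁ inv) (apply A v) i    ≈⟨ apply-cong (proj₁ inv) Av≈0 i ⟩
      apply (proj₁ inv) (λ _ → 0#) i     ≈⟨ apply-zero (proj₁ inv) i ⟩
      0#                                 ∎

  Invertible-mul : ∀ {m} (A B : Matrix m) → Invertible A → Invertible B → Invertible (mul A B)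
  Invertible-mul A B invA@(A′ , _) invB@(B′ , _) = invertible AB-B′A′ B′A′-AB
    where
    AB-B′A′ : ∀ v i → apply (mul A B) (apply (mul B′ A′) v) i ≈ v i
    AB-B′A′ v i = begin
      apply (mul A B) (apply (mul B′ A′) v) i    ≈⟨ apply-mul A B _ i ⟩
      apply A (apply B (apply (mul B′ A′) v)) i  ≈⟨ apply-cong A (apply-cong B (apply-mul B′ A′ v)) i ⟩
      apply A (apply B (apply B′ (apply A′ v))) i ≈⟨ apply-cong A (inverse-applyʳ B invB (apply A′ v)) i ⟩
      apply A (apply A′ v) i                     ≈⟨ inverse-applyʳ A invA v i ⟩
      v i                                        ∎
    B′A′-AB : ∀ v i → apply (mul B′ A′) (apply (mul A B) v) i ≈ v i
    B′A′-AB v i = begin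
      apply (mul B′ A′) (apply (mul A B) v) i    ≈⟨ apply-mul B′ A′ _ i ⟩
      apply B′ (apply A′ (apply (mul A B) v)) i  ≈⟨ apply-cong B′ (apply-cong A′ (apply-mul A B v)) i ⟩
      apply B′ (apply A′ (apply A (apply B v))) i ≈⟨ apply-cong B′ (inverse-applyˡ A invA (apply B v)) i ⟩
      apply B′ (apply B v) i                     ≈⟨ inverse-applyˡ B invB v i ⟩
      v i                                        ∎

  SamePoint-apply : ∀ {m} (A : Matrix m) {v w : Vect m} → SamePoint v w → SamePoint (apply A v) (apply A w)
  SamePoint-apply A (c , c≉0 , v≈cw) = c , c≉0 , λ i → trans (apply-cong A v≈cw i) (apply-* A c _ i)

  elementary : ∀ {m} → Vect m → Vect m → Matrix m
  elementary u d α β = identity α β + u α * d β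

  apply-elementary : ∀ {m} (u d x : Vect m) α → apply (elementary u d) x α ≈ x α + u α * dot d x
  apply-elementary u d x α = begin
    dot (λ β → identity α β + u α * d β) x                  ≈⟨ dot-comm _ x ⟩
    dot x (λ β → identity α β + u α * d β)                  ≈⟨ dot-+ʳ x (identity α) (λ β → u α * d β) ⟩
    dot x (identity α) + dot x (λ β → u α * d β)            ≈⟨ +-cong (trans (dot-comm x _) (dot-identity α x)) (dot-*ʳ x d (u α)) ⟩
    x α + u α * dot x d                                     ≈⟨ +-congˡ (*-congˡ (dot-comm x d)) ⟩
    x α + u α * dot d x                                     ∎

  elementary-fixes : ∀ {m} (u d x : Vect m) → dot d x ≈ 0# → ∀ α → apply (elementary u d) x α ≈ x α
  elementary-fixes u d x dx≈0 α = trans (apply-elementary u d x α) (trans (+-congˡ (trans (*-congˡ dx≈0) (zeroʳ (u α)))) (+-identityʳ (x α)))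

  -- In characteristic 2 this is a transvection rather than a reflection, but still an involution.
  elementary-involutive : ∀ {m} (u d : Vect m) → dot d u ≈ - (1# + 1#) →
                          ∀ x α → apply (elementary u d) (apply (elementary u d) x) α ≈ x α
  elementary-involutive u d du≈-2 x α = begin
    apply R (apply R x) α                      ≈⟨ apply-elementary u d (apply R x) α ⟩
    apply R x α + u α * dot d (apply R x)      ≈⟨ +-cong (apply-elementary u d x α) (*-congˡ d·Rx≈-t) ⟩
    (x α + u α * t) + u α * (- t)              ≈⟨ +-assoc (x α) _ _ ⟩
    x α + (u α * t + u α * (- t))              ≈⟨ +-congˡ (distribˡ (u α) t (- t)) ⟨
    x α + u α * (t - t)                        ≈⟨ +-congˡ (trans (*-congˡ (-‿inverseʳ t)) (zeroʳ (u α))) ⟩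
    x α + 0#                                   ≈⟨ +-identityʳ (x α) ⟩
    x α                                        ∎
    where
    R = elementary u d
    t = dot d x
    d·Rx≈-t : dot d (apply R x) ≈ - t
    d·Rx≈-t = begin
      dot d (apply R x)                        ≈⟨ dot-congʳ d (apply-elementary u d x) ⟩
      dot d (λ β → x β + u β * t)              ≈⟨ dot-+ʳ d x (λ β → u β * t) ⟩
      t + dot d (λ β → u β * t)                ≈⟨ +-congˡ (trans (dot-congʳ d (λ β → *-comm (u β) t)) (dot-*ʳ d u t)) ⟩
      t + t * dot d u                          ≈⟨ +-congˡ (*-congˡ du≈-2) ⟩
      t + t * - (1# + 1#)                      ≈⟨ +-congˡ t*-2≈-[t+t] ⟩
      t + - (t + t)                            ≈⟨ +-congˡ (-‿+-comm t t) ⟨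
      t + (- t + - t)                          ≈⟨ +-assoc t (- t) (- t) ⟨
      (t - t) + - t                            ≈⟨ +-congʳ (-‿inverseʳ t) ⟩
      0# + - t                                 ≈⟨ +-identityˡ (- t) ⟩
      - t                                      ∎
      where
      t*-2≈-[t+t] : t * - (1# + 1#) ≈ - (t + t)
      t*-2≈-[t+t] = trans (sym (-‿distribʳ-* t _)) (-‿cong (trans (distribˡ t 1# 1#) (+-cong (*-identityʳ t) (*-identityʳ t))))

module DiscreteFields where

  open import Data.Fin using (_≟_)
  open import Data.Product using (∃; _,_)
  open import Relation.Binary.PropositionalEquality using (refl)
  open import Relation.Binary.Definitions using (Decidable)
  open import Relation.Nullary using (¬_; yes; no)

  record IsDiscreteField (F : CommutativeRing 0ℓ 0ℓ) : Set where
    open CommutativeRing F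
    field
      0≉1     : ¬ (0# ≈ 1#)
      inverse : ∀ x → ¬ (x ≈ 0#) → ∃ λ y → (x * y) ≈ 1#
      _≈?_    : Decidable _≈_

  IsFiniteField⇒IsDiscreteField : ∀ {F q} → IsFiniteField F q → IsDiscreteField F
  IsFiniteField⇒IsDiscreteField {F} ff = record { 0≉1 = 0≉1 ; inverse = inverse ; _≈?_ = _≈?_ }
    where
    open CommutativeRing F
    open IsFiniteField ff
    _≈?_ : Decidable _≈_
    x ≈? y with enum-surj x | enum-surj y
    ... | i , i↦x | j , j↦y with i ≟ j
    ...   | yes refl = yes (trans (sym i↦x) j↦y)
    ...   | no i≢j   = no (λ x≈y → i≢j (enum-inj i j (trans i↦x (trans x≈y (sym j↦y)))))

open DiscreteFields

module FieldGeometry (F : CommutativeRing 0ℓ 0ℓ) (discrete : IsDiscreteField F) where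

  open import Data.Nat using (zero; _≤_; s≤s)
  open import Data.Fin using (punchIn; punchOut; _≟_) renaming (zero to fzero; suc to fsuc)
  open import Data.Fin.Properties using (any?; punchIn-punchOut)
  open import Data.Vec.Functional using (_∷_; tail)
  open import Data.Product using (∃; _×_; _,_; proj₁; proj₂)
  open import Relation.Binary.PropositionalEquality as ≡ using ()
  open import Relation.Nullary using (¬_; ¬?; yes; no)
  open import Data.Empty using (⊥-elim)
  open import Function using (_∘_)

  open CommutativeRing F
  open IsDiscreteField discrete
  open Geometry F
  open LinearAlgebra F
  open import Relation.Binary.Reasoning.Setoid setoid
  open import Algebra.Properties.Ring ring using (-‿involutive; -0#≈0#; -‿distribˡ-*; -‿+-comm)
  open import Algebra.Properties.CommutativeSemigroup *-commutativeSemigroup using (xy∙z≈zy∙x; interchange)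

  1≉0 : ¬ (1# ≈ 0#)
  1≉0 = 0≉1 ∘ sym

  inverse-nonzero : ∀ {x} (x≉0 : ¬ (x ≈ 0#)) → ¬ (proj₁ (inverse x x≉0) ≈ 0#)
  inverse-nonzero {x} x≉0 y≈0 = 0≉1 (begin
    0#                          ≈⟨ zeroʳ x ⟨
    x * 0#                      ≈⟨ *-congˡ y≈0 ⟨
    x * proj₁ (inverse x x≉0)   ≈⟨ proj₂ (inverse x x≉0) ⟩
    1#                          ∎)

  *-nonzero : ∀ {x y} → ¬ (x ≈ 0#) → ¬ (y ≈ 0#) → ¬ (x * y ≈ 0#)
  *-nonzero {x} {y} x≉0 y≉0 xy≈0 = y≉0 (begin
    y                 ≈⟨ *-identityˡ y ⟨
    1# * y            ≈⟨ *-congʳ (trans (*-comm x⁻¹ x) (proj₂ (inverse x x≉0))) ⟨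
    (x⁻¹ * x) * y     ≈⟨ *-assoc x⁻¹ x y ⟩
    x⁻¹ * (x * y)     ≈⟨ *-congˡ xy≈0 ⟩
    x⁻¹ * 0#          ≈⟨ zeroʳ x⁻¹ ⟩
    0#                ∎)
    where x⁻¹ = proj₁ (inverse x x≉0)

  -‿nonzero : ∀ {x} → ¬ (x ≈ 0#) → ¬ (- x ≈ 0#)
  -‿nonzero {x} x≉0 -x≈0 = x≉0 (trans (sym (-‿involutive x)) (trans (-‿cong -x≈0) -0#≈0#))

  SamePoint-reflexive : ∀ {m} {v w : Vect m} → (∀ i → v i ≈ w i) → SamePoint v w
  SamePoint-reflexive v≈w = 1# , 1≉0 , λ i → trans (v≈w i) (sym (*-identityˡ _))

  module PivotElimination {m} (p : Vect (suc m)) (p₀≉0 : ¬ (p fzero ≈ 0#)) where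

    p₀⁻¹ : Carrier
    p₀⁻¹ = proj₁ (inverse (p fzero) p₀≉0)

    reduce : Vect (suc m) → Vect m
    reduce w j = tail w j - (w fzero * p₀⁻¹) * tail p j

    lift : Vect m → Vect (suc m)
    lift c = - (dot c (tail p) * p₀⁻¹) ∷ c

    dot-lift : ∀ c w → dot (lift c) w ≈ dot c (reduce w)
    dot-lift c w = begin
      - (D * p₀⁻¹) * w₀ + dot c (tail w)                       ≈⟨ +-comm _ _ ⟩
      dot c (tail w) + - (D * p₀⁻¹) * w₀                       ≈⟨ +-congˡ (-‿distribˡ-* (D * p₀⁻¹) w₀) ⟨
      dot c (tail w) + - (D * p₀⁻¹ * w₀)                       ≈⟨ +-congˡ (-‿cong (xy∙z≈zy∙x D p₀⁻¹ w₀)) ⟩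
      dot c (tail w) + - ((w₀ * p₀⁻¹) * D)                     ≈⟨ +-congˡ (-‿cong (dot-*ʳ c (tail p) (w₀ * p₀⁻¹))) ⟨
      dot c (tail w) + - dot c (λ j → (w₀ * p₀⁻¹) * tail p j)  ≈⟨ +-congˡ (dot-negʳ c _) ⟨
      dot c (tail w) + dot c (λ j → - ((w₀ * p₀⁻¹) * tail p j)) ≈⟨ dot-+ʳ c (tail w) _ ⟨
      dot c (reduce w)                                         ∎
      where
      D = dot c (tail p)
      w₀ = w fzero

    reduce-pivot : ∀ j → reduce p j ≈ 0#
    reduce-pivot j = trans (+-congˡ (-‿cong (trans (*-congʳ (proj₂ (inverse (p fzero) p₀≉0))) (*-identityˡ _)))) (-‿inverseʳ _)

  e₀ : ∀ {m} → Vect (suc m)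
  e₀ = 1# ∷ λ _ → 0#

  dot-e₀ : ∀ {m} (v : Vect (suc m)) → dot e₀ v ≈ v fzero
  dot-e₀ v = trans (+-cong (*-identityˡ (v fzero)) (Σ-zero (λ j → zeroˡ (v (fsuc j))))) (+-identityʳ _)

  hyperplane-through : ∀ {k m} → k ≤ m → (w : Fin k → Vect (suc m)) → ∃ λ c → NonZero c × (∀ l → dot c (w l) ≈ 0#)
  hyperplane-through {zero} _ w = e₀ , (λ e₀≈0 → 1≉0 (e₀≈0 fzero)) , λ ()
  hyperplane-through {suc k} {suc m} (s≤s k≤m) w with any? (λ t → ¬? (w t fzero ≈? 0#))
  ... | no no-pivot = e₀ , (λ e₀≈0 → 1≉0 (e₀≈0 fzero)) , λ l → trans (dot-e₀ (w l)) (first≈0 l)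
    where
    first≈0 : ∀ l → w l fzero ≈ 0#
    first≈0 l with w l fzero ≈? 0#
    ... | yes w₀≈0 = w₀≈0
    ... | no w₀≉0 = ⊥-elim (no-pivot (l , w₀≉0))
  ... | yes (t , pivot) = lift c , lift-nonzero , on-hyperplane
    where
    open PivotElimination (w t) pivot
    reduced = hyperplane-through k≤m (λ l → reduce (w (punchIn t l)))
    c = proj₁ reduced
    lift-nonzero : NonZero (lift c)
    lift-nonzero lift≈0 = proj₁ (proj₂ reduced) (λ j → lift≈0 (fsuc j))
    on-hyperplane : ∀ l → dot (lift c) (w l) ≈ 0#
    on-hyperplane l with t ≟ l
    ... | yes ≡.refl = trans (dot-lift c (w t)) (trans (dot-congʳ c reduce-pivot) (dot-zeroʳ c))
    ... | no t≢l = ≡.subst (λ l → dot (lift c) (w l) ≈ 0#) (punchIn-punchOut t≢l)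
                     (trans (dot-lift c (w (punchIn t (punchOut t≢l)))) (proj₂ (proj₂ reduced) (punchOut t≢l)))

  module Reflection {m} (c vp vk : Vect m) (a≉0 : ¬ (dot c vp ≈ 0#)) (b≉0 : ¬ (dot c vk ≈ 0#)) where

    private
      a b a⁻¹ b⁻¹ σ : Carrier
      a = dot c vp
      b = dot c vk
      a⁻¹ = proj₁ (inverse a a≉0)
      b⁻¹ = proj₁ (inverse b b≉0)
      σ = - (a * b⁻¹)
      d u : Vect m
      d i = c i * a⁻¹
      u i = σ * vk i - vp i

      d·x : ∀ x → dot d x ≈ a⁻¹ * dot c x
      d·x x = dot-*ˡ c x a⁻¹

      d·vp≈1 : dot d vp ≈ 1#
      d·vp≈1 = trans (d·x vp) (trans (*-comm a⁻¹ a) (proj₂ (inverse a a≉0)))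

      σ*d·vk≈-1 : σ * dot d vk ≈ - 1#
      σ*d·vk≈-1 = begin
        - (a * b⁻¹) * dot d vk           ≈⟨ *-congˡ (trans (d·x vk) (*-comm a⁻¹ b)) ⟩
        - (a * b⁻¹) * (b * a⁻¹)          ≈⟨ -‿distribˡ-* _ _ ⟨
        - ((a * b⁻¹) * (b * a⁻¹))        ≈⟨ -‿cong (interchange a b⁻¹ b a⁻¹) ⟩
        - ((a * b) * (b⁻¹ * a⁻¹))        ≈⟨ -‿cong (*-congˡ (*-comm b⁻¹ a⁻¹)) ⟩
        - ((a * b) * (a⁻¹ * b⁻¹))        ≈⟨ -‿cong (interchange a b a⁻¹ b⁻¹) ⟩
        - ((a * a⁻¹) * (b * b⁻¹))        ≈⟨ -‿cong (*-cong (proj₂ (inverse a a≉0)) (proj₂ (inverse b b≉0))) ⟩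
        - (1# * 1#)                      ≈⟨ -‿cong (*-identityˡ 1#) ⟩
        - 1#                             ∎

      d·u≈-2 : dot d u ≈ - (1# + 1#)
      d·u≈-2 = begin
        dot d u                                        ≈⟨ dot-+ʳ d (λ i → σ * vk i) (λ i → - vp i) ⟩
        dot d (λ i → σ * vk i) + dot d (λ i → - vp i)  ≈⟨ +-cong (dot-*ʳ d vk σ) (dot-negʳ d vp) ⟩
        σ * dot d vk + - dot d vp                      ≈⟨ +-cong σ*d·vk≈-1 (-‿cong d·vp≈1) ⟩
        - 1# + - 1#                                    ≈⟨ -‿+-comm 1# 1# ⟩
        - (1# + 1#)                                    ∎

    R : Matrix m
    R = elementary u d

    R-involutive : ∀ x α → apply R (apply R x) α ≈ x α
    R-involutive = elementary-involutive u d d·u≈-2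

    R-invertible : Invertible R
    R-invertible = invertible R-involutive R-involutive

    R-fixes : ∀ {x} → dot c x ≈ 0# → ∀ α → apply R x α ≈ x α
    R-fixes {x} c·x≈0 = elementary-fixes u d x (trans (d·x x) (trans (*-congˡ c·x≈0) (zeroʳ a⁻¹)))

    R-sends : SamePoint (apply R vp) vk
    R-sends = σ , -‿nonzero (*-nonzero a≉0 (inverse-nonzero b≉0)) , λ α → begin
      apply R vp α                ≈⟨ apply-elementary u d vp α ⟩
      vp α + u α * dot d vp       ≈⟨ +-congˡ (trans (*-congˡ d·vp≈1) (*-identityʳ (u α))) ⟩
      vp α + (σ * vk α - vp α)    ≈⟨ +-comm (vp α) _ ⟩
      (σ * vk α - vp α) + vp α    ≈⟨ +-assoc _ (- vp α) (vp α) ⟩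
      σ * vk α + (- vp α + vp α)  ≈⟨ +-congˡ (-‿inverseˡ (vp α)) ⟩
      σ * vk α + 0#               ≈⟨ +-identityʳ _ ⟩
      σ * vk α                    ∎

module ProjectiveAction (F : CommutativeRing 0ℓ 0ℓ) (discrete : IsDiscreteField F)
                        {n r : ℕ} (ψ : Geometry.Vect F (suc n) → Fin r) (ψ-bijection : Geometry.IsPointBijection F ψ) where

  open import Data.Nat.Properties using (≤-refl)
  open import Data.Fin using (punchIn; punchOut; _≟_)
  open import Data.Fin.Properties using (punchIn-punchOut; punchOut-injective)
  open import Data.Vec using (lookup; map)
  open import Data.Vec.Properties using (lookup-map)
  open import Data.Product using (∃; _×_; _,_; proj₁; proj₂)
  open import Relation.Binary.PropositionalEquality as ≡ using (_≡_; _≢_)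
  open import Relation.Nullary using (¬_; yes; no)
  open import Function using (_∘_)
  open Positions using (IsPermutation; Swap)

  open CommutativeRing F
  open Geometry F
  open LinearAlgebra F
  open FieldGeometry F discrete

  point : Fin r → Vect (suc n)
  point y = proj₁ (proj₂ ψ-bijection y)

  point-nonzero : ∀ y → NonZero (point y)
  point-nonzero y = proj₁ (proj₂ (proj₂ ψ-bijection y))

  ψ-point : ∀ y → ψ (point y) ≡ y
  ψ-point y = proj₂ (proj₂ (proj₂ ψ-bijection y))

  module _ {v w : Vect (suc n)} (v≉0 : NonZero v) (w≉0 : NonZero w) where

    ψ-SamePoint : SamePoint v w → ψ v ≡ ψ w
    ψ-SamePoint = proj₂ (proj₁ ψ-bijection v w v≉0 w≉0)

    SamePoint-ψ : ψ v ≡ ψ w → SamePoint v w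
    SamePoint-ψ = proj₁ (proj₁ ψ-bijection v w v≉0 w≉0)

    ψ-≈ : (∀ i → v i ≈ w i) → ψ v ≡ ψ w
    ψ-≈ = ψ-SamePoint ∘ SamePoint-reflexive

  induced : Matrix (suc n) → Fin r → Fin r
  induced A y = ψ (apply A (point y))

  induced-ψ : ∀ A → Invertible A → ∀ {v} → NonZero v → induced A (ψ v) ≡ ψ (apply A v)
  induced-ψ A inv {v} v≉0 = ψ-SamePoint (NonZero-apply A inv (point-nonzero (ψ v))) (NonZero-apply A inv v≉0)
    (SamePoint-apply A (SamePoint-ψ (point-nonzero (ψ v)) v≉0 (ψ-point (ψ v))))

  induced-inverse : ∀ A (inv : Invertible A) y → induced (proj₁ inv) (induced A y) ≡ y
  induced-inverse A inv y = ≡.trans (induced-ψ (proj₁ inv) (inverse-invertible A inv) Ay≉0)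
      (≡.trans (ψ-≈ (NonZero-apply (proj₁ inv) (inverse-invertible A inv) Ay≉0) (point-nonzero y) (inverse-applyˡ A inv (point y))) (ψ-point y))
    where Ay≉0 = NonZero-apply A inv (point-nonzero y)

  InΨ-lookup : ∀ π ((A , _) : InΨ ψ π) y → lookup π y ≡ induced A y
  InΨ-lookup π (A , _ , π∘ψ≡ψ∘A) y = ≡.trans (≡.cong (lookup π) (≡.sym (ψ-point y))) (π∘ψ≡ψ∘A (point y) (point-nonzero y))

  InΨ⇒IsPermutation : ∀ {π} → InΨ ψ π → IsPermutation π
  InΨ⇒IsPermutation {π} π∈Ψ@(A , inv , _) = record
    { injective  = λ {a} {b} πa≡πb → ≡.trans (≡.sym (induced-inverse A inv a))
                     (≡.trans (≡.cong (induced (proj₁ inv)) (≡.trans (≡.sym (InΨ-lookup π π∈Ψ a)) (≡.trans πa≡πb (InΨ-lookup π π∈Ψ b))))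
                       (induced-inverse A inv b))
    ; surjective = λ y → induced (proj₁ inv) y , ≡.trans (InΨ-lookup π π∈Ψ _) (induced-inverse (proj₁ inv) (inverse-invertible A inv) y)
    }

  InΨ-induced : ∀ A {π} → Invertible A → InΨ ψ π → InΨ ψ (map (induced A) π)
  InΨ-induced A {π} invA (B , invB , π∘ψ≡ψ∘B) = mul A B , Invertible-mul A B invA invB , λ v v≉0 → begin
    lookup (map (induced A) π) (ψ v)   ≡⟨ lookup-map (ψ v) (induced A) π ⟩
    induced A (lookup π (ψ v))         ≡⟨ ≡.cong (induced A) (π∘ψ≡ψ∘B v v≉0) ⟩
    induced A (ψ (apply B v))          ≡⟨ induced-ψ A invA (NonZero-apply B invB v≉0) ⟩
    ψ (apply A (apply B v))            ≡⟨ ψ-≈ (NonZero-apply A invA (NonZero-apply B invB v≉0)) (NonZero-apply (mul A B) (Invertible-mul A B invA invB) v≉0)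
                                            (λ i → sym (apply-mul A B v i)) ⟩
    ψ (apply (mul A B) v)              ∎
    where open ≡.≡-Reasoning

  module _ {s : Fin (suc (suc n)) → Fin r} (frame : IsFrame ψ s) where

    frame-point : Fin (suc (suc n)) → Vect (suc n)
    frame-point = point ∘ s

    hyperplane-omitting : ∀ {p k} → p ≢ k → ∃ λ c → NonZero c × (∀ {i} → i ≢ p → i ≢ k → dot c (frame-point i) ≈ 0#)
    hyperplane-omitting {p} {k} p≢k = c , proj₁ (proj₂ hyperplane) , on-hyperplane
      where
      k≢p = p≢k ∘ ≡.sym
      others : Fin n → Fin (suc (suc n))
      others l = punchIn k (punchIn (punchOut k≢p) l)
      hyperplane = hyperplane-through ≤-refl (frame-point ∘ others)
      c = proj₁ hyperplane
      on-hyperplane : ∀ {i} → i ≢ p → i ≢ k → dot c (frame-point i) ≈ 0#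
      on-hyperplane {i} i≢p i≢k = ≡.subst (λ i → dot c (frame-point i) ≈ 0#) others-i≡i (proj₂ (proj₂ hyperplane) (punchOut p′≢i′))
        where
        k≢i = i≢k ∘ ≡.sym
        p′≢i′ : punchOut k≢p ≢ punchOut k≢i
        p′≢i′ = i≢p ∘ ≡.sym ∘ punchOut-injective k≢p k≢i
        others-i≡i : others (punchOut p′≢i′) ≡ i
        others-i≡i = ≡.trans (≡.cong (punchIn k) (punchIn-punchOut p′≢i′)) (punchIn-punchOut k≢i)

    off-hyperplane : ∀ {p k c} → NonZero c → (∀ {i} → i ≢ p → i ≢ k → dot c (frame-point i) ≈ 0#) →
                     ¬ (dot c (frame-point p) ≈ 0#)
    off-hyperplane {p} {k} {c} c≉0 c·others≈0 c·p≈0 = frame k c c≉0 λ i i≢k →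
      frame-point i , point-nonzero (s i) , ψ-point (s i) , on-hyperplane i i≢k
      where
      on-hyperplane : ∀ i → i ≢ k → dot c (frame-point i) ≈ 0#
      on-hyperplane i i≢k with i ≟ p
      ... | yes ≡.refl = c·p≈0
      ... | no i≢p = c·others≈0 i≢p i≢k

    frame-swap : ∀ {p k} → p ≢ k → Swap (InΨ ψ) s p k
    frame-swap {p} {k} p≢k = record
      { g          = induced R
      ; involutive = involutive
      ; g-p        = ≡.trans (ψ-SamePoint (R-nonzero (point-nonzero (s p))) (point-nonzero (s k)) R-sends) (ψ-point (s k))
      ; g-other    = λ {i} i≢p i≢k → ≡.trans (ψ-≈ (R-nonzero (point-nonzero (s i))) (point-nonzero (s i))
                                       (R-fixes (c·others≈0 i≢p i≢k))) (ψ-point (s i))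
      ; map-g-Ψ    = λ {π} → InΨ-induced R {π} R-invertible
      }
      where
      hyperplane = hyperplane-omitting p≢k
      c = proj₁ hyperplane
      c≉0 = proj₁ (proj₂ hyperplane)
      c·others≈0 = proj₂ (proj₂ hyperplane)
      open Reflection c (frame-point p) (frame-point k)
        (off-hyperplane c≉0 c·others≈0) (off-hyperplane c≉0 (λ i≢k i≢p → c·others≈0 i≢p i≢k))
      R-nonzero : ∀ {v} → NonZero v → NonZero (apply R v)
      R-nonzero = NonZero-apply R R-invertible
      involutive : ∀ y → induced R (induced R y) ≡ y
      involutive y = ≡.trans (induced-ψ R R-invertible (R-nonzero (point-nonzero y)))
        (≡.trans (ψ-≈ (R-nonzero (R-nonzero (point-nonzero y))) (point-nonzero y) (R-involutive (point y))) (ψ-point y))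

open import Defs
open import Level using (0ℓ)
open import Algebra.Bundles using (CommutativeRing)
open import Data.Nat using (ℕ; suc; _≤_; _*_; _!)
open import Data.Fin using (Fin)
open import Data.Product using (_×_)
open import Function.Definitions using (Injective)
open import Relation.Binary.PropositionalEquality using (_≡_)
open Positions using (covering-count)

lemma3p2 : (F : CommutativeRing 0ℓ 0ℓ) (q : ℕ) → IsFiniteField F q →
           (n : ℕ) → 2 ≤ n →
           (r : ℕ) (ψ : Geometry.Vect F (suc n) → Fin r) → Geometry.IsPointBijection F ψ →
           (s : Fin (suc (suc n)) → Fin r) → Injective _≡_ _≡_ s → Geometry.IsFrame F ψ s →
           (a b : ℕ) → HasSize (Geometry.InΨ F ψ) a →
           HasSize (λ π → Geometry.InΨ F ψ π × Covers π s) b →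
           a ≡ (suc (suc n)) ! * b
lemma3p2 F q finite n _ r ψ ψ-bijection s s-injective frame a b |Ψ|≡a |Ψ∩covers|≡b =
  covering-count s s-injective InΨ⇒IsPermutation (frame-swap frame) |Ψ|≡a |Ψ∩covers|≡b
  where open ProjectiveAction F (IsFiniteField⇒IsDiscreteField finite) ψ ψ-bijection
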